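{- Let $G$ be a simple graph without isolated vertices (a realization of its joint degree matrix). Then there is a finite sequence of restricted swap operations transforming $G$ into a balanced graph $G'$ (which has the same vertex degrees and the same joint degree matrix as $G$).
   Context: Let $V_i$ be the set of vertices of degree $i$, $\Delta$ the maximum degree, and $\mathcal{J}_{ij}=|\{xy\in E: x\in V_i,y\in V_j\}|$. Set $A_j(j)=2\mathcal{J}_{jj}/|V_j|$ and $A_j(i)=\mathcal{J}_{ij}/|V_j|$ for $i\ne j$. The degree spectrum $\mathbf{s}_G(v)$ has $i$-th component equal to the number of neighbors of $v$ of degree $i$. $V_j$ is balanced in $G$ if $\mathbf{s}_G(v)_i\in\{\lfloor A_j(i)\rfloor,\lceil A_j(i)\rceil\}$ for all $v\in V_j$ and all $i$; $G$ is balanced if every $V_j$ is balanced. A swap $ac,bd\Rightarrow bc,ad$ applies to distinct vertices with $ac,bd\in E$, $bc,ad\notin E$ and replaces $E$ by $(E\setminus\{ac,bd\})\cup\{bc,ad\}$; a restricted swap operation (RSO) is a swap in which $a$ and $b$ have the same degree. -}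

module Defs where

open import Data.Nat using (ℕ; zero; suc; _+_; _*_; _≤_)
open import Data.Nat.DivMod using (_/_)
open import Data.Bool using (Bool; true; false; _∧_; _∨_; not; if_then_else_)
open import Data.Fin using (Fin; zero; suc)
open import Data.Fin.Properties using (_≟_)
open import Data.Nat.Properties using () renaming (_≟_ to _≟ℕ_)
open import Data.Sum using (_⊎_)
open import Data.Product using (Σ; _×_; ∃; ∃-syntax)
open import Relation.Nullary using (¬_; yes; no)
open import Relation.Nullary.Decidable using (⌊_⌋)
open import Relation.Binary.PropositionalEquality using (_≡_)
open import Relation.Binary.Construct.Closure.ReflexiveTransitive using (Star)

record Graph (n : ℕ) : Set where
  field
    adj    : Fin n → Fin n → Bool
    sym    : ∀ x y → adj x y ≡ adj y x
    irrefl : ∀ x → adj x x ≡ false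
open Graph public

countF : ∀ {n} → (Fin n → Bool) → ℕ
countF {zero}  p = 0
countF {suc n} p = (if p zero then 1 else 0) + countF (λ x → p (suc x))

sumF : ∀ {n} → (Fin n → ℕ) → ℕ
sumF {zero}  f = 0
sumF {suc n} f = f zero + sumF (λ x → f (suc x))

deg : ∀ {n} → Graph n → Fin n → ℕ
deg G v = countF (adj G v)

sizeV : ∀ {n} → Graph n → ℕ → ℕ
sizeV G i = countF (λ v → ⌊ deg G v ≟ℕ i ⌋)

spec : ∀ {n} → Graph n → Fin n → ℕ → ℕ
spec G v i = countF (λ u → adj G v u ∧ ⌊ deg G u ≟ℕ i ⌋)

ordPairs : ∀ {n} → Graph n → ℕ → ℕ → ℕ
ordPairs G i j = sumF (λ x → if ⌊ deg G x ≟ℕ i ⌋ then spec G x j else 0)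

-- J_ij = |{xy ∈ E : x ∈ V_i, y ∈ V_j}| (unordered edges).
-- For i ≠ j each such edge corresponds to exactly one ordered pair;
-- for i = j each edge is counted twice among ordered pairs.
J : ∀ {n} → Graph n → ℕ → ℕ → ℕ
J G i j with i ≟ℕ j
... | yes _ = ordPairs G i j / 2
... | no  _ = ordPairs G i j

-- numerator of A_j(i): A_j(j) = 2 J_jj / |V_j|, A_j(i) = J_ij / |V_j| (i ≠ j)
Anum : ∀ {n} → Graph n → ℕ → ℕ → ℕ
Anum G j i with i ≟ℕ j
... | yes _ = 2 * J G j j
... | no  _ = J G i j

-- ⌊ N / d ⌋ and ⌈ N / d ⌉ ; the case d = 0 never arises below
-- (d = |V_j| with V_j ∋ v nonempty) and is given the dummy value 0.
floorDiv : ℕ → ℕ → ℕ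
floorDiv N zero    = 0
floorDiv N (suc k) = N / suc k

ceilDiv : ℕ → ℕ → ℕ
ceilDiv N zero    = 0
ceilDiv N (suc k) = (N + k) / suc k

BalancedClass : ∀ {n} → Graph n → ℕ → Set
BalancedClass G j = ∀ v → deg G v ≡ j → ∀ i →
  (spec G v i ≡ floorDiv (Anum G j i) (sizeV G j)) ⊎
  (spec G v i ≡ ceilDiv  (Anum G j i) (sizeV G j))

Balanced : ∀ {n} → Graph n → Set
Balanced G = ∀ j → BalancedClass G j

sameEdge : ∀ {n} → Fin n → Fin n → Fin n → Fin n → Bool
sameEdge x y u v = (⌊ x ≟ u ⌋ ∧ ⌊ y ≟ v ⌋) ∨ (⌊ x ≟ v ⌋ ∧ ⌊ y ≟ u ⌋)

swapAdj : ∀ {n} → Graph n → (a b c d : Fin n) → Fin n → Fin n → Bool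
swapAdj G a b c d x y =
  (adj G x y ∧ not (sameEdge x y a c) ∧ not (sameEdge x y b d))
  ∨ sameEdge x y b c ∨ sameEdge x y a d

IsSwap : ∀ {n} → Graph n → (a b c d : Fin n) → Graph n → Set
IsSwap G a b c d H =
  ¬ a ≡ b × ¬ a ≡ c × ¬ a ≡ d × ¬ b ≡ c × ¬ b ≡ d × ¬ c ≡ d ×
  adj G a c ≡ true × adj G b d ≡ true ×
  adj G b c ≡ false × adj G a d ≡ false ×
  (∀ x y → adj H x y ≡ swapAdj G a b c d x y)

RSO : ∀ {n} → Graph n → Graph n → Set
RSO G H = ∃[ a ] ∃[ b ] ∃[ c ] ∃[ d ] (deg G a ≡ deg G b × IsSwap G a b c d H)

RSO* : ∀ {n} → Graph n → Graph n → Set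
RSO* = Star RSO

module Submission where

-- Call G near-balanced if vertices of equal degree have spectra differing by at
-- most one in each coordinate.  The proof is a descent on the potential
-- Φ G = Σ_v Σ_t s_G(v)_t², the inner sum running over the possible degrees 0..n:
--  * an RSO keeps all degrees and the numbers of ordered edge pairs between
--    degree classes, hence J (module AfterSwap);
--  * if s_G(a)_i ≥ s_G(b)_i + 2 with deg a = deg b, counting and a pigeonhole
--    argument locate an RSO ac, bd ⇒ bc, ad that lowers Φ (module FindSite);
--  * a near-balanced graph is balanced, as A_j(i) is the average of the values
--    s_G(v)_i over V_j, which lie within one of each other (near-average).

open import Defs
open import Data.Nat using (ℕ; _≤_)
open import Data.Product using (Σ; _×_; ∃-syntax)
open import Relation.Binary.PropositionalEquality using (_≡_)

open import Data.Nat using (zero; suc; _+_; _*_; _<_; s≤s; z≤n; _≤?_; _<?_; NonZero)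
open import Data.Nat.Properties hiding (_≟_)
open import Data.Nat.Properties using () renaming (_≟_ to _≟ℕ_)
open import Data.Nat.DivMod using (_/_; m*n/n≡m; /-monoˡ-≤; m<n*o⇒m/o<n)
open import Data.Nat.Induction using (<-wellFounded)
open import Data.Nat.Tactic.RingSolver using (solve-∀)
open import Data.Bool using (Bool; true; false; _∧_; not; if_then_else_)
open import Data.Bool.Properties using (∧-zeroʳ; ∧-identityʳ; ∨-identityʳ; ∨-zeroʳ; ∧-comm; ∨-comm)
open import Data.Fin using (Fin; zero; suc; toℕ; fromℕ<; punchIn)
open import Data.Fin.Properties using (_≟_; any?; toℕ-injective; toℕ-fromℕ<; punchInᵢ≢i)
open import Data.Vec.Functional using (updateAt)
open import Data.Vec.Functional.Properties using (updateAt-updates; updateAt-minimal)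
open import Data.Sum using (_⊎_; inj₁; inj₂) renaming (swap to ⊎-swap)
open import Data.Product using (_,_; proj₁; proj₂; ∃)
open import Function using (_∘_)
open import Relation.Nullary using (¬_; Dec; yes; no; contradiction)
open import Relation.Nullary.Decidable using (⌊_⌋; ¬?; _×-dec_)
open import Relation.Binary.PropositionalEquality as ≡
  using (_≢_; refl; trans; cong; cong₂; subst; subst₂; module ≡-Reasoning)
open import Relation.Binary.Construct.Closure.ReflexiveTransitive using (ε; _◅_)
open import Induction.WellFounded using (Acc; acc)
open import Algebra.Properties.Semiring.Sum +-*-semiring
  using (sum; sum-cong-≗; sum-remove; ∑-distrib-+; ∑-comm; *-distribˡ-sum)

𝟙 : Bool → ℕ
𝟙 b = if b then 1 else 0

𝟙≤1 : ∀ b → 𝟙 b ≤ 1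
𝟙≤1 true  = ≤-refl
𝟙≤1 false = z≤n

𝟙-∧ : ∀ p q → 𝟙 (p ∧ q) ≡ 𝟙 p * 𝟙 q
𝟙-∧ true  q = ≡.sym (+-identityʳ (𝟙 q))
𝟙-∧ false q = refl

𝟙-∧≤ʳ : ∀ p q → 𝟙 (p ∧ q) ≤ 𝟙 q
𝟙-∧≤ʳ true  q = ≤-refl
𝟙-∧≤ʳ false q = z≤n

∧-true : ∀ {p q} → p ∧ q ≡ true → p ≡ true × q ≡ true
∧-true {true} {true} _ = refl , refl

⌊⌋-yes : ∀ {A : Set} (a? : Dec A) → A → ⌊ a? ⌋ ≡ true
⌊⌋-yes (yes _) _ = refl
⌊⌋-yes (no ¬a) a = contradiction a ¬a

⌊⌋-no : ∀ {A : Set} (a? : Dec A) → ¬ A → ⌊ a? ⌋ ≡ false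
⌊⌋-no (yes a) ¬a = contradiction a ¬a
⌊⌋-no (no _)  _  = refl

⌊⌋-true : ∀ {A : Set} (a? : Dec A) → ⌊ a? ⌋ ≡ true → A
⌊⌋-true (yes a) _ = a

+-exchange : ∀ {x y z w p q : ℕ} → x + p ≡ y + q → z + q ≡ w + p → x + z ≡ y + w
+-exchange {x} {y} {z} {w} {p} {q} e₁ e₂ = +-cancelʳ-≡ (p + q) _ _ (begin
  x + z + (p + q)   ≡⟨ regroup x z p q ⟩
  x + p + (z + q)   ≡⟨ cong₂ _+_ e₁ e₂ ⟩
  y + q + (w + p)   ≡⟨ regroup' y w q p ⟩
  y + w + (p + q)   ∎)
  where
  open ≡-Reasoning
  regroup : ∀ x z p q → x + z + (p + q) ≡ x + p + (z + q)
  regroup = solve-∀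
  regroup' : ∀ y w q p → y + q + (w + p) ≡ y + w + (p + q)
  regroup' = solve-∀

if-pair : ∀ (p q : Bool) → p ≡ q → ∀ {x y x′ y′ : ℕ} → x + y ≡ x′ + y′ →
          (if p then x else 0) + (if q then y else 0) ≡ (if p then x′ else 0) + (if q then y′ else 0)
if-pair true  _ refl e = e
if-pair false _ refl e = refl

<-by-excess : ∀ {A C x y : ℕ} → A + x ≡ C + y → y < x → A < C
<-by-excess {A} {C} {x} {y} e y<x with A <? C
... | yes A<C = A<C
... | no A≮C  = contradiction e (<⇒≢ (+-mono-≤-< (≮⇒≥ A≮C) y<x) ∘ ≡.sym)

div-unique : ∀ {A t s} .{{_ : NonZero s}} → t * s ≤ A → A < suc t * s → A / s ≡ t
div-unique {A} {t} {s} lo hi =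
  ≤-antisym (≤-pred (m<n*o⇒m/o<n hi)) (subst (_≤ A / s) (m*n/n≡m t s) (/-monoˡ-≤ s lo))

floor-or-ceil : ∀ {A m s} → 1 ≤ s → s * m < A + s → A < s * suc m →
                m ≡ floorDiv A s ⊎ m ≡ ceilDiv A s
floor-or-ceil {A} {m} {suc s′} _ lo hi with m * suc s′ ≤? A
... | yes ms≤A = inj₁ (≡.sym (div-unique ms≤A (subst (A <_) (*-comm (suc s′) (suc m)) hi)))
... | no  ms≰A = inj₂ (≡.sym (div-unique lo′ hi′))
  where
  lo′ : m * suc s′ ≤ A + s′
  lo′ = ≤-pred (subst₂ _<_ (*-comm (suc s′) m) (+-suc A s′) lo)
  hi′ : A + s′ < suc m * suc s′
  hi′ = subst (A + s′ <_) (+-comm (m * suc s′) (suc s′)) (+-mono-<-≤ (≰⇒> ms≰A) (n≤1+n s′))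

-- Finite sums over Fin n.

-- sumF agrees with the library's summation, whose algebra (congruence,
-- linearity, Fubini, removing a point) is transported by the next lemmas.
sumF≡sum : ∀ {n} (f : Fin n → ℕ) → sumF f ≡ sum f
sumF≡sum {zero}  f = refl
sumF≡sum {suc n} f = cong (f zero +_) (sumF≡sum (λ x → f (suc x)))

sumF-cong : ∀ {n} {f g : Fin n → ℕ} → (∀ x → f x ≡ g x) → sumF f ≡ sumF g
sumF-cong {f = f} {g} f≗g = trans (sumF≡sum f) (trans (sum-cong-≗ f≗g) (≡.sym (sumF≡sum g)))

sumF-+ : ∀ {n} (f g : Fin n → ℕ) → sumF (λ x → f x + g x) ≡ sumF f + sumF g
sumF-+ f g =
  trans (sumF≡sum (λ x → f x + g x)) (trans (∑-distrib-+ f g) (≡.sym (cong₂ _+_ (sumF≡sum f) (sumF≡sum g))))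

sumF-*ˡ : ∀ {n} (c : ℕ) (f : Fin n → ℕ) → sumF (λ x → c * f x) ≡ c * sumF f
sumF-*ˡ c f =
  trans (sumF≡sum (λ x → c * f x)) (≡.sym (trans (cong (c *_) (sumF≡sum f)) (*-distribˡ-sum c f)))

sumF-comm : ∀ {m n} (f : Fin m → Fin n → ℕ) →
            sumF (λ x → sumF (f x)) ≡ sumF (λ y → sumF (λ x → f x y))
sumF-comm f = begin
  sumF (λ x → sumF (f x))           ≡⟨ sumF²≡sum² f ⟩
  sum (λ x → sum (f x))             ≡⟨ ∑-comm f ⟩
  sum (λ y → sum (λ x → f x y))     ≡⟨ ≡.sym (sumF²≡sum² (λ y x → f x y)) ⟩
  sumF (λ y → sumF (λ x → f x y))   ∎
  where
  open ≡-Reasoning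
  sumF²≡sum² : ∀ {m n} (g : Fin m → Fin n → ℕ) → sumF (λ x → sumF (g x)) ≡ sum (λ x → sum (g x))
  sumF²≡sum² g = trans (sumF-cong (λ x → sumF≡sum (g x))) (sumF≡sum (λ x → sum (g x)))

sumF-zero : ∀ {n} → sumF {n} (λ _ → 0) ≡ 0
sumF-zero {zero}  = refl
sumF-zero {suc n} = sumF-zero {n}

sumF-mono : ∀ {n} {f g : Fin n → ℕ} → (∀ x → f x ≤ g x) → sumF f ≤ sumF g
sumF-mono {zero}  f≤g = z≤n
sumF-mono {suc n} f≤g = +-mono-≤ (f≤g zero) (sumF-mono (λ x → f≤g (suc x)))

sumF-strict : ∀ {n} {f g : Fin n → ℕ} → (∀ x → f x ≤ g x) → (v : Fin n) → f v < g v → sumF f < sumF g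
sumF-strict {suc n} f≤g zero    fv<gv = +-mono-<-≤ fv<gv (sumF-mono (λ x → f≤g (suc x)))
sumF-strict {suc n} f≤g (suc v) fv<gv = +-mono-≤-< (f≤g zero) (sumF-strict (λ x → f≤g (suc x)) v fv<gv)

sumF-exchange : ∀ {n} (f g : Fin n → ℕ) (x : Fin n) → (∀ y → y ≢ x → f y ≡ g y) →
                sumF f + g x ≡ sumF g + f x
sumF-exchange {suc n} f g x agree = begin
  sumF f + g x                    ≡⟨ cong (_+ g x) (trans (sumF≡sum f) (sum-remove {i = x} f)) ⟩
  f x + sum (without-x f) + g x          ≡⟨ cong (λ r → f x + r + g x) (sum-cong-≗ λ j → agree _ (punchInᵢ≢i x j)) ⟩
  f x + sum (without-x g) + g x          ≡⟨ swap-ends (f x) (sum (without-x g)) (g x) ⟩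
  g x + sum (without-x g) + f x          ≡⟨ cong (_+ f x) (≡.sym (trans (sumF≡sum g) (sum-remove {i = x} g))) ⟩
  sumF g + f x                    ∎
  where
  open ≡-Reasoning
  without-x : (Fin (suc n) → ℕ) → Fin n → ℕ
  without-x h j = h (punchIn x j)
  swap-ends : ∀ u r v → u + r + v ≡ v + r + u
  swap-ends = solve-∀

sumF-exchange₂ : ∀ {n} (f g : Fin n → ℕ) (x z : Fin n) → x ≢ z →
                 (∀ y → y ≢ x → y ≢ z → f y ≡ g y) →
                 sumF f + g x + g z ≡ sumF g + f x + f z
sumF-exchange₂ {n} f g x z x≢z agree = begin
  sumF f + g x + g z    ≡⟨ cong (λ t → sumF f + t + g z) (≡.sym hx) ⟩
  sumF f + h x + g z    ≡⟨ cong (_+ g z) (sumF-exchange f h x f≈h) ⟩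
  sumF h + f x + g z    ≡⟨ +-right-swap (sumF h) (f x) (g z) ⟩
  sumF h + g z + f x    ≡⟨ cong (_+ f x) (sumF-exchange h g z h≈g) ⟩
  sumF g + h z + f x    ≡⟨ cong (λ t → sumF g + t + f x) hz ⟩
  sumF g + f z + f x    ≡⟨ +-right-swap (sumF g) (f z) (f x) ⟩
  sumF g + f x + f z    ∎
  where
  open ≡-Reasoning
  h : Fin n → ℕ
  h = updateAt f x (λ _ → g x)
  hx : h x ≡ g x
  hx = updateAt-updates x f
  hz : h z ≡ f z
  hz = updateAt-minimal z x f (λ z≡x → x≢z (≡.sym z≡x))
  f≈h : ∀ y → y ≢ x → f y ≡ h y
  f≈h y y≢x = ≡.sym (updateAt-minimal y x f y≢x)
  h≈g : ∀ y → y ≢ z → h y ≡ g y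
  h≈g y y≢z with y ≟ x
  ... | yes refl = hx
  ... | no y≢x   = trans (≡.sym (f≈h y y≢x)) (agree y y≢x y≢z)
  +-right-swap : ∀ u v w → u + v + w ≡ u + w + v
  +-right-swap = solve-∀

symmetric-sum-even : ∀ {n} (f : Fin n → Fin n → ℕ) → (∀ x y → f x y ≡ f y x) → (∀ x → f x x ≡ 0) →
                     ∃ λ T → sumF (λ x → sumF (f x)) ≡ T + T
symmetric-sum-even {zero}  f f-sym f-diag = 0 , refl
symmetric-sum-even {suc n} f f-sym f-diag with symmetric-sum-even (λ x y → f (suc x) (suc y))
                                                 (λ x y → f-sym (suc x) (suc y)) (λ x → f-diag (suc x))
... | T , inner = R + T , (begin
  f zero zero + R + sumF (λ x → f (suc x) zero + sumF (λ y → f (suc x) (suc y)))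
    ≡⟨ cong₂ (λ u v → u + R + v) (f-diag zero) (sumF-+ (λ x → f (suc x) zero) (λ x → sumF (λ y → f (suc x) (suc y)))) ⟩
  R + (sumF (λ x → f (suc x) zero) + sumF (λ x → sumF (λ y → f (suc x) (suc y))))
    ≡⟨ cong₂ (λ u v → R + (u + v)) (sumF-cong (λ x → f-sym (suc x) zero)) inner ⟩
  R + (R + (T + T))
    ≡⟨ regroup R T ⟩
  R + T + (R + T)   ∎)
  where
  open ≡-Reasoning
  -- the first row without its diagonal entry; by symmetry also the first column
  R : ℕ
  R = sumF (λ y → f zero (suc y))
  regroup : ∀ R T → R + (R + (T + T)) ≡ R + T + (R + T)
  regroup = solve-∀

-- Counting elements of boolean predicates on Fin n.

countF≡sumF : ∀ {n} (p : Fin n → Bool) → countF p ≡ sumF (λ x → 𝟙 (p x))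
countF≡sumF {zero}  p = refl
countF≡sumF {suc n} p = cong (𝟙 (p zero) +_) (countF≡sumF (λ x → p (suc x)))

countF-cong : ∀ {n} {p q : Fin n → Bool} → (∀ x → p x ≡ q x) → countF p ≡ countF q
countF-cong {p = p} {q} p≗q =
  trans (countF≡sumF p) (trans (sumF-cong (λ x → cong 𝟙 (p≗q x))) (≡.sym (countF≡sumF q)))

countF≤ : ∀ {n} (p : Fin n → Bool) → countF p ≤ n
countF≤ {zero}  p = z≤n
countF≤ {suc n} p with p zero
... | true  = s≤s (countF≤ (λ x → p (suc x)))
... | false = m≤n⇒m≤1+n (countF≤ (λ x → p (suc x)))

countF-pos : ∀ {n} (p : Fin n → Bool) (v : Fin n) → p v ≡ true → 1 ≤ countF p
countF-pos p zero    pv rewrite pv = s≤s z≤n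
countF-pos p (suc v) pv = ≤-trans (countF-pos (λ x → p (suc x)) v pv) (m≤n+m _ (𝟙 (p zero)))

countF-witness : ∀ {n} (p : Fin n → Bool) → 1 ≤ countF p → ∃ λ v → p v ≡ true
countF-witness {zero}  p ()
countF-witness {suc n} p pos with p zero in p0
... | true  = zero , p0
... | false = let (v , pv) = countF-witness (λ x → p (suc x)) pos in suc v , pv

sumF-if : ∀ {n} (p : Fin n → Bool) (K : ℕ) → sumF (λ x → if p x then K else 0) ≡ countF p * K
sumF-if {zero}  p K = refl
sumF-if {suc n} p K with p zero
... | true  = cong (K +_) (sumF-if (λ x → p (suc x)) K)
... | false = sumF-if (λ x → p (suc x)) K

count-at : ∀ {n} (p : Fin n → Bool) (x : Fin n) → countF (λ u → p u ∧ ⌊ u ≟ x ⌋) ≡ 𝟙 (p x)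
count-at {n} p x = begin
  countF (λ u → p u ∧ ⌊ u ≟ x ⌋)          ≡⟨ countF≡sumF (λ u → p u ∧ ⌊ u ≟ x ⌋) ⟩
  sumF f                                  ≡⟨ ≡.sym (+-identityʳ (sumF f)) ⟩
  sumF f + 0                              ≡⟨ sumF-exchange f (λ _ → 0) x off-x ⟩
  sumF {n} (λ _ → 0) + f x                ≡⟨ cong₂ _+_ (sumF-zero {n}) (cong (λ b → 𝟙 (p x ∧ b)) (⌊⌋-yes (x ≟ x) refl)) ⟩
  𝟙 (p x ∧ true)                          ≡⟨ cong 𝟙 (∧-identityʳ (p x)) ⟩
  𝟙 (p x)                                 ∎
  where
  open ≡-Reasoning
  f : Fin n → ℕ
  f u = 𝟙 (p u ∧ ⌊ u ≟ x ⌋)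
  off-x : ∀ u → u ≢ x → f u ≡ 0
  off-x u u≢x = trans (cong (λ b → 𝟙 (p u ∧ b)) (⌊⌋-no (u ≟ x) u≢x)) (cong 𝟙 (∧-zeroʳ (p u)))

coord-count : ∀ {N} m → m < N → sumF {N} (λ t → 𝟙 ⌊ m ≟ℕ toℕ t ⌋) ≡ 1
coord-count {N} m m<N = trans (sumF-cong (λ t → cong 𝟙 (same-test t)))
                              (trans (≡.sym (countF≡sumF (λ t → ⌊ t ≟ x ⌋))) (count-at (λ _ → true) x))
  where
  x : Fin N
  x = fromℕ< m<N
  same-test : ∀ t → ⌊ m ≟ℕ toℕ t ⌋ ≡ ⌊ t ≟ x ⌋
  same-test t with m ≟ℕ toℕ t | t ≟ x
  ... | yes _    | yes _   = refl
  ... | no _     | no _    = refl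
  ... | yes m≡t  | no t≢x  = contradiction (toℕ-injective (trans (≡.sym m≡t) (≡.sym (toℕ-fromℕ< m<N)))) t≢x
  ... | no m≢t   | yes t≡x = contradiction (trans (≡.sym (toℕ-fromℕ< m<N)) (cong toℕ (≡.sym t≡x))) m≢t

count-move : ∀ {n} (r s w : Fin n → Bool) {p q : Fin n} → p ≢ q →
             (∀ y → y ≢ p → y ≢ q → s y ≡ r y) →
             r p ≡ true → r q ≡ false → s p ≡ false → s q ≡ true →
             countF (λ y → s y ∧ w y) + 𝟙 (w p) ≡ countF (λ y → r y ∧ w y) + 𝟙 (w q)
count-move {n} r s w {p} {q} p≢q s≈r rp rq sp sq = begin
  countF (λ y → s y ∧ w y) + 𝟙 (w p)   ≡⟨ cong₂ _+_ (countF≡sumF (λ y → s y ∧ w y)) (≡.sym fp) ⟩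
  sumF g + f p                         ≡⟨ trans (≡.sym (+-identityʳ _)) (cong (sumF g + f p +_) (≡.sym fq)) ⟩
  sumF g + f p + f q                   ≡⟨ ≡.sym (sumF-exchange₂ f g p q p≢q f≈g) ⟩
  sumF f + g p + g q                   ≡⟨ cong₂ (λ u v → sumF f + u + v) gp gq ⟩
  sumF f + 0 + 𝟙 (w q)                 ≡⟨ cong (_+ 𝟙 (w q)) (trans (+-identityʳ _) (≡.sym (countF≡sumF (λ y → r y ∧ w y)))) ⟩
  countF (λ y → r y ∧ w y) + 𝟙 (w q)   ∎
  where
  open ≡-Reasoning
  f g : Fin n → ℕ
  f y = 𝟙 (r y ∧ w y)
  g y = 𝟙 (s y ∧ w y)
  f≈g : ∀ y → y ≢ p → y ≢ q → f y ≡ g y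
  f≈g y y≢p y≢q = cong (λ b → 𝟙 (b ∧ w y)) (≡.sym (s≈r y y≢p y≢q))
  fp : f p ≡ 𝟙 (w p)
  fp = cong (λ b → 𝟙 (b ∧ w p)) rp
  fq : f q ≡ 0
  fq = cong (λ b → 𝟙 (b ∧ w q)) rq
  gp : g p ≡ 0
  gp = cong (λ b → 𝟙 (b ∧ w p)) sp
  gq : g q ≡ 𝟙 (w q)
  gq = cong (λ b → 𝟙 (b ∧ w q)) sq

count-excess-witness : ∀ {n} (P Q : Fin n → Bool) (x : Fin n) →
                       countF Q + 1 + 𝟙 (P x) ≤ countF P →
                       ∃ λ u → u ≢ x × P u ≡ true × Q u ≡ false
count-excess-witness {n} P Q x excess =
  let (u , Ru) = countF-witness R (+-cancelˡ-≤ (countF Q) 1 (countF R)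
                   (+-cancelʳ-≤ (𝟙 (P x)) (countF Q + 1) (countF Q + countF R) (≤-trans excess bound)))
  in u , decode u Ru
  where
  open ≤-Reasoning
  R : Fin n → Bool
  R u = P u ∧ not (Q u) ∧ not ⌊ u ≟ x ⌋
  split : ∀ u → 𝟙 (P u) ≤ 𝟙 (Q u) + 𝟙 (P u ∧ not (Q u) ∧ not ⌊ u ≟ x ⌋) + 𝟙 (P u ∧ ⌊ u ≟ x ⌋)
  split u with P u | Q u | ⌊ u ≟ x ⌋
  ... | true  | true  | _     = s≤s z≤n
  ... | true  | false | true  = s≤s z≤n
  ... | true  | false | false = s≤s z≤n
  ... | false | _     | _     = z≤n
  bound : countF P ≤ countF Q + countF R + 𝟙 (P x)
  bound = begin
    countF P                                                  ≡⟨ countF≡sumF P ⟩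
    sumF (λ u → 𝟙 (P u))                                      ≤⟨ sumF-mono split ⟩
    sumF (λ u → 𝟙 (Q u) + 𝟙 (R u) + 𝟙 (P u ∧ ⌊ u ≟ x ⌋))     ≡⟨ sumF-+ (λ u → 𝟙 (Q u) + 𝟙 (R u)) _ ⟩
    sumF (λ u → 𝟙 (Q u) + 𝟙 (R u)) + sumF (λ u → 𝟙 (P u ∧ ⌊ u ≟ x ⌋))
                                 ≡⟨ cong₂ _+_ (sumF-+ (λ u → 𝟙 (Q u)) (λ u → 𝟙 (R u)))
                                              (≡.sym (countF≡sumF (λ u → P u ∧ ⌊ u ≟ x ⌋))) ⟩
    sumF (λ u → 𝟙 (Q u)) + sumF (λ u → 𝟙 (R u)) + countF (λ u → P u ∧ ⌊ u ≟ x ⌋)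
                                 ≡⟨ cong₂ _+_ (cong₂ _+_ (≡.sym (countF≡sumF Q)) (≡.sym (countF≡sumF R)))
                                              (count-at P x) ⟩
    countF Q + countF R + 𝟙 (P x)                             ∎
  decode : ∀ u → P u ∧ not (Q u) ∧ not ⌊ u ≟ x ⌋ ≡ true → u ≢ x × P u ≡ true × Q u ≡ false
  decode u Ru with P u | Q u | u ≟ x | Ru
  ... | true | false | no u≢x | _ = u≢x , refl , refl

surplus-elsewhere : ∀ {N} (f g e : Fin N → ℕ) (i : Fin N) →
                    sumF f ≡ sumF g → sumF e ≤ 1 → g i + 2 ≤ f i →
                    ∃ λ k → k ≢ i × f k + 1 + e k ≤ g k
surplus-elsewhere {N} f g e i Σf≡Σg Σe≤1 gap
  with any? (λ k → ¬? (k ≟ i) ×-dec (f k + 1 + e k ≤? g k))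
... | yes found = found
... | no none = contradiction (begin-strict
      sumF g + 1        <⟨ +-monoʳ-< (sumF g) (s≤s (s≤s z≤n)) ⟩
      sumF g + 2        ≡⟨ Σg+2≡Σh ⟩
      sumF h            ≤⟨ sumF-mono h≤f+e ⟩
      sumF (λ k → f k + e k) ≡⟨ sumF-+ f e ⟩
      sumF f + sumF e   ≤⟨ +-monoʳ-≤ (sumF f) Σe≤1 ⟩
      sumF f + 1        ≡⟨ cong (_+ 1) Σf≡Σg ⟩
      sumF g + 1        ∎) (<-irrefl refl)
  where
  open ≤-Reasoning
  h : Fin N → ℕ
  h = updateAt g i (_+ 2)
  hi : h i ≡ g i + 2
  hi = updateAt-updates i g
  h≤f+e : ∀ k → h k ≤ f k + e k
  h≤f+e k with k ≟ i
  ... | yes refl = ≤-trans (≤-reflexive hi) (≤-trans gap (m≤m+n (f k) (e k)))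
  ... | no k≢i with f k + 1 + e k ≤? g k
  ...   | yes better = contradiction (k , k≢i , better) none
  ...   | no worse = ≤-trans (≤-reflexive (updateAt-minimal k i g k≢i))
                       (≤-pred (≤-trans (≰⇒> worse) (≤-reflexive (+-suc-right (f k) (e k)))))
    where +-suc-right : ∀ u v → u + 1 + v ≡ suc (u + v)
          +-suc-right = solve-∀
  Σg+2≡Σh : sumF g + 2 ≡ sumF h
  Σg+2≡Σh = +-cancelʳ-≡ (g i) _ _ (begin-equality
    sumF g + 2 + g i   ≡⟨ +-assoc (sumF g) 2 (g i) ⟩
    sumF g + (2 + g i) ≡⟨ cong (sumF g +_) (trans (+-comm 2 (g i)) (≡.sym hi)) ⟩
    sumF g + h i       ≡⟨ sumF-exchange g h i (λ y y≢i → ≡.sym (updateAt-minimal y i g y≢i)) ⟩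
    sumF h + g i       ∎)

near-average : ∀ {n} (p : Fin n → Bool) (m : Fin n → ℕ) (v : Fin n) → p v ≡ true →
               (∀ w → p w ≡ true → m w ≤ m v + 1 × m v ≤ m w + 1) →
               m v ≡ floorDiv (sumF (λ w → if p w then m w else 0)) (countF p) ⊎
               m v ≡ ceilDiv  (sumF (λ w → if p w then m w else 0)) (countF p)
near-average {n} p m v pv close = floor-or-ceil (countF-pos p v pv) lower upper
  where
  F : Fin n → ℕ
  F w = if p w then m w else 0
  upper : sumF F < countF p * suc (m v)
  upper = <-≤-trans (sumF-strict bound v at-v) (≤-reflexive (sumF-if p (suc (m v))))
    where
    bound : ∀ w → F w ≤ (if p w then suc (m v) else 0)
    bound w with p w in pw
    ... | true  = ≤-trans (proj₁ (close w pw)) (≤-reflexive (+-comm (m v) 1))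
    ... | false = z≤n
    at-v : F v < (if p v then suc (m v) else 0)
    at-v rewrite pv = ≤-refl
  lower : countF p * m v < sumF F + countF p
  lower = begin-strict
    countF p * m v                          ≡⟨ ≡.sym (sumF-if p (m v)) ⟩
    sumF (λ w → if p w then m v else 0)     <⟨ sumF-strict bound v at-v ⟩
    sumF (λ w → F w + 𝟙 (p w))              ≡⟨ sumF-+ F (λ w → 𝟙 (p w)) ⟩
    sumF F + sumF (λ w → 𝟙 (p w))           ≡⟨ cong (sumF F +_) (≡.sym (countF≡sumF p)) ⟩
    sumF F + countF p                       ∎
    where
    open ≤-Reasoning
    bound : ∀ w → (if p w then m v else 0) ≤ F w + 𝟙 (p w)
    bound w with p w in pw
    ... | true  = proj₂ (close w pw)
    ... | false = z≤n
    at-v : (if p v then m v else 0) < F v + 𝟙 (p v)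
    at-v rewrite pv = ≤-reflexive (+-comm 1 (m v))

-- Squares, written out so that the ring solver sees products.
sq : ℕ → ℕ
sq x = x * x

-- The arithmetic behind sq-move, with x + 1 units moving down to x and y up to y + 1.
sq-move-arith : ∀ F G x y → F + sq x + sq (y + 1) ≡ G + sq (x + 1) + sq y →
                G + 2 * (x + 1) ≡ F + 2 * y + 2
sq-move-arith F G x y e = +-cancelʳ-≡ (x * x + y * y) _ _ (begin
  G + 2 * (x + 1) + (x * x + y * y)        ≡⟨ expand-G G x y ⟩
  G + (x + 1) * (x + 1) + y * y + 1        ≡⟨ cong (_+ 1) (≡.sym e) ⟩
  F + x * x + (y + 1) * (y + 1) + 1        ≡⟨ expand-F F x y ⟩
  F + 2 * y + 2 + (x * x + y * y)          ∎)
  where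
  open ≡-Reasoning
  expand-G : ∀ G x y → G + 2 * (x + 1) + (x * x + y * y) ≡ G + (x + 1) * (x + 1) + y * y + 1
  expand-G = solve-∀
  expand-F : ∀ F x y → F + x * x + (y + 1) * (y + 1) + 1 ≡ F + 2 * y + 2 + (x * x + y * y)
  expand-F = solve-∀

sq-move : ∀ {N} (f g : Fin N → ℕ) {i k : Fin N} → i ≢ k →
          (∀ t → g t + 𝟙 ⌊ toℕ i ≟ℕ toℕ t ⌋ ≡ f t + 𝟙 ⌊ toℕ k ≟ℕ toℕ t ⌋) →
          sumF (λ t → sq (g t)) + 2 * f i ≡ sumF (λ t → sq (f t)) + 2 * f k + 2
sq-move f g {i} {k} i≢k moved = begin
  Σg² + 2 * f i          ≡⟨ cong (λ s → Σg² + 2 * s) (≡.sym gi) ⟩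
  Σg² + 2 * (g i + 1)    ≡⟨ sq-move-arith Σf² Σg² (g i) (f k) squares ⟩
  Σf² + 2 * f k + 2      ∎
  where
  open ≡-Reasoning
  Σf² Σg² : ℕ
  Σf² = sumF (λ t → sq (f t))
  Σg² = sumF (λ t → sq (g t))
  ind-self : ∀ x → 𝟙 ⌊ toℕ x ≟ℕ toℕ x ⌋ ≡ 1
  ind-self x = cong 𝟙 (⌊⌋-yes (toℕ x ≟ℕ toℕ x) refl)
  ind-other : ∀ {x t} → t ≢ x → 𝟙 ⌊ toℕ x ≟ℕ toℕ t ⌋ ≡ 0
  ind-other {x} {t} t≢x = cong 𝟙 (⌊⌋-no (toℕ x ≟ℕ toℕ t) (t≢x ∘ ≡.sym ∘ toℕ-injective))
  gi : g i + 1 ≡ f i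
  gi = trans (cong (g i +_) (≡.sym (ind-self i)))
             (trans (moved i) (trans (cong (f i +_) (ind-other i≢k)) (+-identityʳ (f i))))
  gk : g k ≡ f k + 1
  gk = trans (≡.sym (+-identityʳ (g k))) (trans (cong (g k +_) (≡.sym (ind-other (i≢k ∘ ≡.sym))))
             (trans (moved k) (cong (f k +_) (ind-self k))))
  same : ∀ t → t ≢ i → t ≢ k → sq (f t) ≡ sq (g t)
  same t t≢i t≢k = cong sq (+-cancelʳ-≡ 0 _ _ (begin
    f t + 0                    ≡⟨ cong (f t +_) (≡.sym (ind-other t≢k)) ⟩
    f t + 𝟙 ⌊ toℕ k ≟ℕ toℕ t ⌋ ≡⟨ ≡.sym (moved t) ⟩
    g t + 𝟙 ⌊ toℕ i ≟ℕ toℕ t ⌋ ≡⟨ cong (g t +_) (ind-other t≢i) ⟩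
    g t + 0                    ∎))
  squares : Σf² + sq (g i) + sq (f k + 1) ≡ Σg² + sq (g i + 1) + sq (f k)
  squares = begin
    Σf² + sq (g i) + sq (f k + 1)  ≡⟨ cong (λ s → Σf² + sq (g i) + sq s) (≡.sym gk) ⟩
    Σf² + sq (g i) + sq (g k)      ≡⟨ sumF-exchange₂ (λ t → sq (f t)) (λ t → sq (g t)) i k i≢k same ⟩
    Σg² + sq (f i) + sq (f k)      ≡⟨ cong (λ s → Σg² + sq s + sq (f k)) (≡.sym gi) ⟩
    Σg² + sq (g i + 1) + sq (f k)  ∎

-- Two opposite unit moves with surpluses 2 and 1 lower the total energy.
energy-pair-arith : ∀ {Ha Hb Ga Gb xa ya xb yb : ℕ} →
                    Ha + 2 * xa ≡ Ga + 2 * ya + 2 → Hb + 2 * yb ≡ Gb + 2 * xb + 2 →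
                    xb + 2 ≤ xa → ya + 1 ≤ yb → Ha + Hb < Ga + Gb
energy-pair-arith {Ha} {Hb} {Ga} {Gb} {xa} {ya} {xb} {yb} e₁ e₂ gap₁ gap₂ =
  <-by-excess {x = 2 * xa + 2 * yb} {y = 2 * ya + 2 * xb + 4} total
    (<-≤-trans (m<m+n _ (s≤s z≤n))
      (≤-trans (≤-reflexive (split ya xb)) (+-mono-≤ (*-monoʳ-≤ 2 gap₁) (*-monoʳ-≤ 2 gap₂))))
  where
  open ≡-Reasoning
  regroup : ∀ A B x y → A + B + (x + y) ≡ A + x + (B + y)
  regroup = solve-∀
  regroup′ : ∀ A B y x → A + y + 2 + (B + x + 2) ≡ A + B + (y + x + 4)
  regroup′ = solve-∀
  split : ∀ ya xb → 2 * ya + 2 * xb + 4 + 2 ≡ 2 * (xb + 2) + 2 * (ya + 1)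
  split = solve-∀
  total : Ha + Hb + (2 * xa + 2 * yb) ≡ Ga + Gb + (2 * ya + 2 * xb + 4)
  total = begin
    Ha + Hb + (2 * xa + 2 * yb)             ≡⟨ regroup Ha Hb (2 * xa) (2 * yb) ⟩
    Ha + 2 * xa + (Hb + 2 * yb)             ≡⟨ cong₂ _+_ e₁ e₂ ⟩
    Ga + 2 * ya + 2 + (Gb + 2 * xb + 2)     ≡⟨ regroup′ Ga Gb (2 * ya) (2 * xb) ⟩
    Ga + Gb + (2 * ya + 2 * xb + 4)         ∎

-- Degree classes, spectra, the potential Φ, and the joint degree counts.

class : ∀ {n} → Graph n → ℕ → Fin n → Bool
class G t u = ⌊ deg G u ≟ℕ t ⌋

nbrsIn : ∀ {n} → Graph n → Fin n → (Fin n → Bool) → ℕ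
nbrsIn K x w = countF (λ y → adj K x y ∧ w y)

deg≡nbrsIn : ∀ {n} (K : Graph n) (x : Fin n) → deg K x ≡ nbrsIn K x (λ _ → true)
deg≡nbrsIn K x = countF-cong (λ y → ≡.sym (∧-identityʳ (adj K x y)))

-- Degrees are at most n, so they are among the spectrum coordinates.
deg<suc : ∀ {n} (G : Graph n) u → deg G u < suc n
deg<suc G u = s≤s (countF≤ (adj G u))

spec-total : ∀ {n} (G : Graph n) v → sumF {suc n} (λ t → spec G v (toℕ t)) ≡ deg G v
spec-total {n} G v = begin
  sumF {suc n} (λ t → spec G v (toℕ t))
    ≡⟨ sumF-cong {suc n} (λ t → countF≡sumF (λ u → adj G v u ∧ class G (toℕ t) u)) ⟩
  sumF {suc n} (λ t → sumF (λ u → 𝟙 (adj G v u ∧ class G (toℕ t) u)))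
    ≡⟨ sumF-comm {suc n} (λ t u → 𝟙 (adj G v u ∧ class G (toℕ t) u)) ⟩
  sumF (λ u → sumF {suc n} (λ t → 𝟙 (adj G v u ∧ class G (toℕ t) u)))
    ≡⟨ sumF-cong (λ u → trans (sumF-cong {suc n} (λ t → 𝟙-∧ (adj G v u) (class G (toℕ t) u)))
                              (sumF-*ˡ {suc n} (𝟙 (adj G v u)) (λ t → 𝟙 (class G (toℕ t) u)))) ⟩
  sumF (λ u → 𝟙 (adj G v u) * sumF {suc n} (λ t → 𝟙 (class G (toℕ t) u)))
    ≡⟨ sumF-cong (λ u → trans (cong (𝟙 (adj G v u) *_) (coord-count (deg G u) (deg<suc G u)))
                              (*-identityʳ (𝟙 (adj G v u)))) ⟩
  sumF (λ u → 𝟙 (adj G v u))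
    ≡⟨ ≡.sym (countF≡sumF (adj G v)) ⟩
  deg G v ∎
  where open ≡-Reasoning

energy : ∀ {n} → Graph n → Fin n → ℕ
energy {n} K v = sumF {suc n} (λ t → sq (spec K v (toℕ t)))

Φ : ∀ {n} → Graph n → ℕ
Φ K = sumF (energy K)

pair-ind : ∀ {n} → Graph n → ℕ → ℕ → Fin n → Fin n → ℕ
pair-ind G i j x y = 𝟙 (class G i x ∧ (adj G x y ∧ class G j y))

ordPairs-double : ∀ {n} (G : Graph n) i j → ordPairs G i j ≡ sumF (λ x → sumF (pair-ind G i j x))
ordPairs-double G i j = sumF-cong (λ x → restrict (class G i x) (λ y → adj G x y ∧ class G j y))
  where
  restrict : ∀ {n} b (P : Fin n → Bool) → (if b then countF P else 0) ≡ sumF (λ y → 𝟙 (b ∧ P y))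
  restrict {n} true  P = countF≡sumF P
  restrict {n} false P = ≡.sym (sumF-zero {n})

pair-ind-sym : ∀ {n} (G : Graph n) i j x y → pair-ind G i j x y ≡ pair-ind G j i y x
pair-ind-sym G i j x y rewrite Graph.sym G y x = cong 𝟙 (flip (class G i x) (adj G x y) (class G j y))
  where
  flip : ∀ p q r → p ∧ (q ∧ r) ≡ r ∧ (q ∧ p)
  flip true  true  true  = refl
  flip true  true  false = refl
  flip true  false r     = ≡.sym (∧-zeroʳ r)
  flip false q     true  = ≡.sym (∧-zeroʳ q)
  flip false q     false = refl

ordPairs-sym : ∀ {n} (G : Graph n) i j → ordPairs G i j ≡ ordPairs G j i
ordPairs-sym G i j = begin
  ordPairs G i j                                 ≡⟨ ordPairs-double G i j ⟩
  sumF (λ x → sumF (pair-ind G i j x))           ≡⟨ sumF-comm (pair-ind G i j) ⟩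
  sumF (λ y → sumF (λ x → pair-ind G i j x y))   ≡⟨ sumF-cong (λ y → sumF-cong (λ x → pair-ind-sym G i j x y)) ⟩
  sumF (λ y → sumF (pair-ind G j i y))           ≡⟨ ≡.sym (ordPairs-double G j i) ⟩
  ordPairs G j i                                 ∎
  where open ≡-Reasoning

-- Each edge inside V_j is counted twice among the ordered pairs.
ordPairs-even : ∀ {n} (G : Graph n) j → ∃ λ T → ordPairs G j j ≡ T + T
ordPairs-even G j =
  let (T , even) = symmetric-sum-even (pair-ind G j j) (pair-ind-sym G j j) no-loop
  in T , trans (ordPairs-double G j j) even
  where
  no-loop : ∀ x → pair-ind G j j x x ≡ 0
  no-loop x rewrite irrefl G x = cong 𝟙 (∧-zeroʳ (class G j x))

J-diag : ∀ {n} (G : Graph n) i → J G i i ≡ ordPairs G i i / 2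
J-diag G i with i ≟ℕ i
... | yes _  = refl
... | no i≢i = contradiction refl i≢i

J-off : ∀ {n} (G : Graph n) {i j} → i ≢ j → J G i j ≡ ordPairs G i j
J-off G {i} {j} i≢j with i ≟ℕ j
... | yes i≡j = contradiction i≡j i≢j
... | no _    = refl

Anum≡ordPairs : ∀ {n} (G : Graph n) j i → Anum G j i ≡ ordPairs G j i
Anum≡ordPairs G j i with i ≟ℕ j
... | no i≢j   = trans (J-off G i≢j) (ordPairs-sym G i j)
... | yes refl with ordPairs-even G i
...   | T , even = begin
  2 * J G i i              ≡⟨ cong (2 *_) (trans (J-diag G i) (cong (_/ 2) even)) ⟩
  2 * ((T + T) / 2)        ≡⟨ cong (λ s → 2 * (s / 2)) (twice T) ⟩
  2 * (T * 2 / 2)          ≡⟨ cong (2 *_) (m*n/n≡m T 2) ⟩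
  2 * T                    ≡⟨ twice′ T ⟩
  T + T                    ≡⟨ ≡.sym even ⟩
  ordPairs G i i           ∎
  where
  open ≡-Reasoning
  twice : ∀ T → T + T ≡ T * 2
  twice = solve-∀
  twice′ : ∀ T → 2 * T ≡ T + T
  twice′ = solve-∀

J-cong : ∀ {n} (G K : Graph n) → (∀ i j → ordPairs G i j ≡ ordPairs K i j) → ∀ i j → J G i j ≡ J K i j
J-cong G K same i j with i ≟ℕ j
... | yes _ = cong (_/ 2) (same i j)
... | no _  = same i j

-- Restricted swaps and their effect on degrees, spectra, ordered pair counts and Φ.

sameEdge-refl : ∀ {n} (u v : Fin n) → sameEdge u v u v ≡ true
sameEdge-refl u v rewrite ⌊⌋-yes (u ≟ u) refl | ⌊⌋-yes (v ≟ v) refl = refl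

sameEdge-sym : ∀ {n} (x y u v : Fin n) → sameEdge x y u v ≡ sameEdge y x u v
sameEdge-sym x y u v
  rewrite ∧-comm ⌊ x ≟ u ⌋ ⌊ y ≟ v ⌋ | ∧-comm ⌊ x ≟ v ⌋ ⌊ y ≟ u ⌋ = ∨-comm (⌊ y ≟ v ⌋ ∧ ⌊ x ≟ u ⌋) _

pair-false : ∀ {n} {x y u v : Fin n} → (x ≢ u ⊎ y ≢ v) → (⌊ x ≟ u ⌋ ∧ ⌊ y ≟ v ⌋) ≡ false
pair-false {x = x} {y} {u} {v} (inj₁ x≢u) rewrite ⌊⌋-no (x ≟ u) x≢u = refl
pair-false {x = x} {y} {u} {v} (inj₂ y≢v) rewrite ⌊⌋-no (y ≟ v) y≢v = ∧-zeroʳ ⌊ x ≟ u ⌋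

sameEdge-false : ∀ {n} {x y u v : Fin n} → (x ≢ u ⊎ y ≢ v) → (x ≢ v ⊎ y ≢ u) → sameEdge x y u v ≡ false
sameEdge-false h₁ h₂ rewrite pair-false h₁ | pair-false h₂ = refl

loop-not : ∀ {n} (x : Fin n) {u v : Fin n} → u ≢ v → sameEdge x x u v ≡ false
loop-not x u≢v = sameEdge-false (≢-one-of x u≢v) (⊎-swap (≢-one-of x u≢v))
  where
  ≢-one-of : ∀ {n} {u v : Fin n} (x : Fin n) → u ≢ v → x ≢ u ⊎ x ≢ v
  ≢-one-of {u = u} x u≢v with x ≟ u
  ... | yes refl = inj₂ u≢v
  ... | no x≢u   = inj₁ x≢u

-- The graph (E ∖ {ac, bd}) ∪ {bc, ad}; it is loopless since b ≠ c and a ≠ d.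
swapGraph : ∀ {n} (G : Graph n) (a b c d : Fin n) → b ≢ c → a ≢ d → Graph n
swapGraph G a b c d b≢c a≢d = record
  { adj    = swapAdj G a b c d
  ; sym    = symmetric
  ; irrefl = loopless }
  where
  symmetric : ∀ x y → swapAdj G a b c d x y ≡ swapAdj G a b c d y x
  symmetric x y rewrite Graph.sym G x y | sameEdge-sym x y a c | sameEdge-sym x y b d
                      | sameEdge-sym x y b c | sameEdge-sym x y a d = refl
  loopless : ∀ x → swapAdj G a b c d x x ≡ false
  loopless x rewrite irrefl G x | loop-not x b≢c | loop-not x a≢d = refl

record SwapSite {n} (G : Graph n) : Set where
  field
    a b c d : Fin n
    a≢b : a ≢ b
    a≢c : a ≢ c
    a≢d : a ≢ d
    b≢c : b ≢ c
    b≢d : b ≢ d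
    c≢d : c ≢ d
    ac∈G : adj G a c ≡ true
    bd∈G : adj G b d ≡ true
    bc∉G : adj G b c ≡ false
    ad∉G : adj G a d ≡ false
    deg-a≡deg-b : deg G a ≡ deg G b

module AfterSwap {n} (G : Graph n) (S : SwapSite G) where
  open SwapSite S

  H : Graph n
  H = swapGraph G a b c d b≢c a≢d

  isRSO : RSO G H
  isRSO = a , b , c , d , deg-a≡deg-b ,
          a≢b , a≢c , a≢d , b≢c , b≢d , c≢d , ac∈G , bd∈G , bc∉G , ad∉G , (λ _ _ → refl)

  b≢a : b ≢ a
  b≢a = a≢b ∘ ≡.sym
  c≢a : c ≢ a
  c≢a = a≢c ∘ ≡.sym
  d≢a : d ≢ a
  d≢a = a≢d ∘ ≡.sym
  c≢b : c ≢ b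
  c≢b = b≢c ∘ ≡.sym
  d≢b : d ≢ b
  d≢b = b≢d ∘ ≡.sym
  d≢c : d ≢ c
  d≢c = c≢d ∘ ≡.sym

  ac∉H : adj H a c ≡ false
  ac∉H rewrite ac∈G | sameEdge-refl a c | sameEdge-false {x = a} {c} {b} {c} (inj₁ a≢b) (inj₁ a≢c)
             | sameEdge-false {x = a} {c} {a} {d} (inj₂ c≢d) (inj₁ a≢d) = refl
  bd∉H : adj H b d ≡ false
  bd∉H rewrite bd∈G | sameEdge-refl b d | sameEdge-false {x = b} {d} {a} {c} (inj₁ b≢a) (inj₁ b≢c)
             | sameEdge-false {x = b} {d} {b} {c} (inj₂ d≢c) (inj₁ b≢c)
             | sameEdge-false {x = b} {d} {a} {d} (inj₁ b≢a) (inj₁ b≢d) = refl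
  bc∈H : adj H b c ≡ true
  bc∈H rewrite sameEdge-refl b c = ∨-zeroʳ _
  ad∈H : adj H a d ≡ true
  ad∈H rewrite sameEdge-refl a d | sameEdge-false {x = a} {d} {b} {c} (inj₁ a≢b) (inj₁ a≢c) = ∨-zeroʳ _

  unchanged : ∀ x y → sameEdge x y a c ≡ false → sameEdge x y b d ≡ false →
              sameEdge x y b c ≡ false → sameEdge x y a d ≡ false → adj H x y ≡ adj G x y
  unchanged x y e₁ e₂ e₃ e₄ rewrite e₁ | e₂ | e₃ | e₄ = trans (∨-identityʳ _) (∧-identityʳ _)

  a-fixed : ∀ y → y ≢ c → y ≢ d → adj H a y ≡ adj G a y
  a-fixed y y≢c y≢d = unchanged a y (sameEdge-false (inj₂ y≢c) (inj₁ a≢c)) (sameEdge-false (inj₁ a≢b) (inj₁ a≢d))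
                                    (sameEdge-false (inj₁ a≢b) (inj₁ a≢c)) (sameEdge-false (inj₂ y≢d) (inj₁ a≢d))
  b-fixed : ∀ y → y ≢ d → y ≢ c → adj H b y ≡ adj G b y
  b-fixed y y≢d y≢c = unchanged b y (sameEdge-false (inj₁ b≢a) (inj₁ b≢c)) (sameEdge-false (inj₂ y≢d) (inj₁ b≢d))
                                    (sameEdge-false (inj₂ y≢c) (inj₁ b≢c)) (sameEdge-false (inj₁ b≢a) (inj₁ b≢d))
  c-fixed : ∀ y → y ≢ a → y ≢ b → adj H c y ≡ adj G c y
  c-fixed y y≢a y≢b = unchanged c y (sameEdge-false (inj₁ c≢a) (inj₂ y≢a)) (sameEdge-false (inj₁ c≢b) (inj₁ c≢d))
                                    (sameEdge-false (inj₁ c≢b) (inj₂ y≢b)) (sameEdge-false (inj₁ c≢a) (inj₁ c≢d))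
  d-fixed : ∀ y → y ≢ b → y ≢ a → adj H d y ≡ adj G d y
  d-fixed y y≢b y≢a = unchanged d y (sameEdge-false (inj₁ d≢a) (inj₁ d≢c)) (sameEdge-false (inj₁ d≢b) (inj₂ y≢b))
                                    (sameEdge-false (inj₁ d≢b) (inj₁ d≢c)) (sameEdge-false (inj₁ d≢a) (inj₂ y≢a))
  other-fixed : ∀ x → x ≢ a → x ≢ b → x ≢ c → x ≢ d → ∀ y → adj H x y ≡ adj G x y
  other-fixed x x≢a x≢b x≢c x≢d y =
    unchanged x y (sameEdge-false (inj₁ x≢a) (inj₁ x≢c)) (sameEdge-false (inj₁ x≢b) (inj₁ x≢d))
                  (sameEdge-false (inj₁ x≢b) (inj₁ x≢c)) (sameEdge-false (inj₁ x≢a) (inj₁ x≢d))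

  a-row : ∀ w → nbrsIn H a w + 𝟙 (w c) ≡ nbrsIn G a w + 𝟙 (w d)
  a-row w = count-move (adj G a) (adj H a) w c≢d a-fixed ac∈G ad∉G ac∉H ad∈H
  b-row : ∀ w → nbrsIn H b w + 𝟙 (w d) ≡ nbrsIn G b w + 𝟙 (w c)
  b-row w = count-move (adj G b) (adj H b) w d≢c b-fixed bd∈G bc∉G bd∉H bc∈H
  c-row : ∀ w → nbrsIn H c w + 𝟙 (w a) ≡ nbrsIn G c w + 𝟙 (w b)
  c-row w = count-move (adj G c) (adj H c) w a≢b c-fixed
              (trans (Graph.sym G c a) ac∈G) (trans (Graph.sym G c b) bc∉G)
              (trans (Graph.sym H c a) ac∉H) (trans (Graph.sym H c b) bc∈H)
  d-row : ∀ w → nbrsIn H d w + 𝟙 (w b) ≡ nbrsIn G d w + 𝟙 (w a)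
  d-row w = count-move (adj G d) (adj H d) w b≢a d-fixed
              (trans (Graph.sym G d b) bd∈G) (trans (Graph.sym G d a) ad∉G)
              (trans (Graph.sym H d b) bd∉H) (trans (Graph.sym H d a) ad∈H)
  other-row : ∀ x → x ≢ a → x ≢ b → x ≢ c → x ≢ d → ∀ w → nbrsIn H x w ≡ nbrsIn G x w
  other-row x x≢a x≢b x≢c x≢d w = countF-cong (λ y → cong (_∧ w y) (other-fixed x x≢a x≢b x≢c x≢d y))

  deg-kept : ∀ x → nbrsIn H x (λ _ → true) + 1 ≡ nbrsIn G x (λ _ → true) + 1 → deg H x ≡ deg G x
  deg-kept x e = trans (deg≡nbrsIn H x) (trans (+-cancelʳ-≡ 1 _ _ e) (≡.sym (deg≡nbrsIn G x)))

  by-site : (P : Fin n → Set) → P a → P b → P c → P d →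
            (∀ x → x ≢ a → x ≢ b → x ≢ c → x ≢ d → P x) → ∀ x → P x
  by-site P pa pb pc pd po x with x ≟ a | x ≟ b | x ≟ c | x ≟ d
  ... | yes refl | _        | _        | _        = pa
  ... | no _     | yes refl | _        | _        = pb
  ... | no _     | no _     | yes refl | _        = pc
  ... | no _     | no _     | no _     | yes refl = pd
  ... | no x≢a   | no x≢b   | no x≢c   | no x≢d   = po x x≢a x≢b x≢c x≢d

  deg-H : ∀ x → deg H x ≡ deg G x
  deg-H = by-site (λ x → deg H x ≡ deg G x)
    (deg-kept a (a-row all)) (deg-kept b (b-row all)) (deg-kept c (c-row all)) (deg-kept d (d-row all))
    (λ x x≢a x≢b x≢c x≢d → countF-cong (other-fixed x x≢a x≢b x≢c x≢d))
    where
    all : Fin n → Bool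
    all _ = true

  -- Since degrees are kept, spectra in H count neighbours in the classes of G.
  spec-H : ∀ v t → spec H v t ≡ nbrsIn H v (class G t)
  spec-H v t = countF-cong (λ u → cong (λ s → adj H v u ∧ ⌊ s ≟ℕ t ⌋) (deg-H u))

  same-class : ∀ t → class G t a ≡ class G t b
  same-class t = cong (λ s → ⌊ s ≟ℕ t ⌋) deg-a≡deg-b

  a-spec : ∀ t → spec H a t + 𝟙 (class G t c) ≡ spec G a t + 𝟙 (class G t d)
  a-spec t = trans (cong (_+ 𝟙 (class G t c)) (spec-H a t)) (a-row (class G t))

  b-spec : ∀ t → spec H b t + 𝟙 (class G t d) ≡ spec G b t + 𝟙 (class G t c)
  b-spec t = trans (cong (_+ 𝟙 (class G t d)) (spec-H b t)) (b-row (class G t))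

  -- c and d trade a neighbour for one of the same degree, so only a and b change spectra.
  fixed-spec : ∀ v → v ≢ a → v ≢ b → ∀ t → spec H v t ≡ spec G v t
  fixed-spec = by-site (λ v → v ≢ a → v ≢ b → ∀ t → spec H v t ≡ spec G v t)
    (λ a≢a _ → contradiction refl a≢a)
    (λ _ b≢b → contradiction refl b≢b)
    (λ _ _ t → +-cancelʳ-≡ (𝟙 (class G t a)) _ _ (trans (cong (_+ 𝟙 (class G t a)) (spec-H c t))
      (trans (c-row (class G t)) (cong (λ s → spec G c t + 𝟙 s) (≡.sym (same-class t))))))
    (λ _ _ t → +-cancelʳ-≡ (𝟙 (class G t b)) _ _ (trans (cong (_+ 𝟙 (class G t b)) (spec-H d t))
      (trans (d-row (class G t)) (cong (λ s → spec G d t + 𝟙 s) (same-class t)))))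
    (λ v v≢a v≢b v≢c v≢d _ _ t → trans (spec-H v t) (other-row v v≢a v≢b v≢c v≢d (class G t)))

  ab-spec : ∀ t → spec H a t + spec H b t ≡ spec G a t + spec G b t
  ab-spec t = +-exchange {spec H a t} {spec G a t} {spec H b t} {spec G b t} (a-spec t) (b-spec t)

  ordPairs-H : ∀ i j → ordPairs H i j ≡ ordPairs G i j
  ordPairs-H i j = begin
    ordPairs H i j   ≡⟨ sumF-cong (λ x → cong (λ s → if ⌊ s ≟ℕ i ⌋ then spec H x j else 0) (deg-H x)) ⟩
    sumF F′          ≡⟨ +-cancelʳ-≡ (F′ a + F′ b) _ _ exchanged ⟩
    ordPairs G i j   ∎
    where
    open ≡-Reasoning
    F′ : Fin n → ℕ
    F′ x = if class G i x then spec H x j else 0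
    F : Fin n → ℕ
    F x = if class G i x then spec G x j else 0
    exchanged : sumF F′ + (F′ a + F′ b) ≡ sumF F + (F′ a + F′ b)
    exchanged = begin
      sumF F′ + (F′ a + F′ b) ≡⟨ cong (sumF F′ +_) (if-pair _ _ (same-class i) (ab-spec j)) ⟩
      sumF F′ + (F a + F b)   ≡⟨ ≡.sym (+-assoc (sumF F′) _ _) ⟩
      sumF F′ + F a + F b     ≡⟨ ≡.sym (sumF-exchange₂ F F′ a b a≢b
                                   (λ y y≢a y≢b → cong (λ s → if class G i y then s else 0)
                                                       (≡.sym (fixed-spec y y≢a y≢b j)))) ⟩
      sumF F + F′ a + F′ b    ≡⟨ +-assoc (sumF F) _ _ ⟩
      sumF F + (F′ a + F′ b)  ∎

  Φ-lower : ∀ {i k : Fin (suc n)} → i ≢ k → deg G c ≡ toℕ i → deg G d ≡ toℕ k →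
            spec G b (toℕ i) + 2 ≤ spec G a (toℕ i) → spec G a (toℕ k) + 1 ≤ spec G b (toℕ k) →
            Φ H < Φ G
  Φ-lower {i} {k} i≢k deg-c deg-d surplus-a surplus-b =
    <-by-excess {x = energy G a + energy G b} {y = energy H a + energy H b}
      (trans (≡.sym (+-assoc (Φ H) _ _)) (trans (sumF-exchange₂ (energy H) (energy G) a b a≢b same-energy)
             (+-assoc (Φ G) _ _)))
      (energy-pair-arith {energy H a} {energy H b} {energy G a} {energy G b} energy-a energy-b surplus-a surplus-b)
    where
    a-moves : ∀ t → spec H a (toℕ t) + 𝟙 ⌊ toℕ i ≟ℕ toℕ t ⌋ ≡ spec G a (toℕ t) + 𝟙 ⌊ toℕ k ≟ℕ toℕ t ⌋
    a-moves t = subst₂ (λ p q → spec H a (toℕ t) + 𝟙 ⌊ p ≟ℕ toℕ t ⌋ ≡ spec G a (toℕ t) + 𝟙 ⌊ q ≟ℕ toℕ t ⌋)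
                       deg-c deg-d (a-spec (toℕ t))
    b-moves : ∀ t → spec H b (toℕ t) + 𝟙 ⌊ toℕ k ≟ℕ toℕ t ⌋ ≡ spec G b (toℕ t) + 𝟙 ⌊ toℕ i ≟ℕ toℕ t ⌋
    b-moves t = subst₂ (λ q p → spec H b (toℕ t) + 𝟙 ⌊ q ≟ℕ toℕ t ⌋ ≡ spec G b (toℕ t) + 𝟙 ⌊ p ≟ℕ toℕ t ⌋)
                       deg-d deg-c (b-spec (toℕ t))
    energy-a : energy H a + 2 * spec G a (toℕ i) ≡ energy G a + 2 * spec G a (toℕ k) + 2
    energy-a = sq-move (λ t → spec G a (toℕ t)) (λ t → spec H a (toℕ t)) i≢k a-moves
    energy-b : energy H b + 2 * spec G b (toℕ k) ≡ energy G b + 2 * spec G b (toℕ i) + 2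
    energy-b = sq-move (λ t → spec G b (toℕ t)) (λ t → spec H b (toℕ t)) (i≢k ∘ ≡.sym) b-moves
    same-energy : ∀ v → v ≢ a → v ≢ b → energy H v ≡ energy G v
    same-energy v v≢a v≢b = sumF-cong {suc n} (λ t → cong sq (fixed-spec v v≢a v≢b (toℕ t)))

-- Every violation of near-balance yields an improving restricted swap.

Violation : ∀ {n} → Graph n → Set
Violation {n} G = ∃ λ a → ∃ λ b → ∃ λ (i : Fin (suc n)) →
                  deg G a ≡ deg G b × spec G b (toℕ i) + 2 ≤ spec G a (toℕ i)

record Improvement {n} (G : Graph n) : Set where
  field
    H       : Graph n
    rso     : RSO G H
    lower   : Φ H < Φ G
    degrees : ∀ x → deg H x ≡ deg G x
    pairs   : ∀ i j → ordPairs H i j ≡ ordPairs G i j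

status-differs : ∀ {n} (G : Graph n) {x y z} → adj G x y ≡ false → adj G x z ≡ true → y ≢ z
status-differs G {x} xy∉G xz∈G y≡z with trans (≡.sym xy∉G) (trans (cong (adj G x) y≡z) xz∈G)
... | ()

-- Locating the swap: with a having two more neighbours of degree i than b, pick
--   c: a neighbour of a of degree i, not adjacent to b (and c ≠ b);
--   k: a degree where b has more neighbours than a, even after a's own contribution;
--   d: a neighbour of b of degree k, not adjacent to a (and d ≠ a).
module FindSite {n} (G : Graph n) (a b : Fin n) (i : Fin (suc n)) (deg-a≡deg-b : deg G a ≡ deg G b)
                (surplus-a : spec G b (toℕ i) + 2 ≤ spec G a (toℕ i)) where

  N : Fin n → ℕ → Fin n → Bool
  N x t u = adj G x u ∧ class G t u

  c-found : ∃ λ c → c ≢ b × N a (toℕ i) c ≡ true × N b (toℕ i) c ≡ false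
  c-found = count-excess-witness (N a (toℕ i)) (N b (toℕ i)) b
              (≤-trans (+-monoʳ-≤ (spec G b (toℕ i) + 1) (𝟙≤1 (N a (toℕ i) b)))
                       (≤-trans (≤-reflexive (+-assoc (spec G b (toℕ i)) 1 1)) surplus-a))

  k-found : ∃ λ k → k ≢ i × spec G a (toℕ k) + 1 + 𝟙 (class G (toℕ k) a) ≤ spec G b (toℕ k)
  k-found = surplus-elsewhere (λ t → spec G a (toℕ t)) (λ t → spec G b (toℕ t)) (λ t → 𝟙 (class G (toℕ t) a)) i
              (trans (spec-total G a) (trans deg-a≡deg-b (≡.sym (spec-total G b))))
              (≤-reflexive (coord-count (deg G a) (deg<suc G a))) surplus-a

  k : Fin (suc n)
  k = proj₁ k-found

  d-found : ∃ λ d → d ≢ a × N b (toℕ k) d ≡ true × N a (toℕ k) d ≡ false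
  d-found = count-excess-witness (N b (toℕ k)) (N a (toℕ k)) a
              (≤-trans (+-monoʳ-≤ (spec G a (toℕ k) + 1) (𝟙-∧≤ʳ (adj G b a) (class G (toℕ k) a)))
                       (proj₂ (proj₂ k-found)))

  in-N : ∀ {x t u} → N x t u ≡ true → adj G x u ≡ true × deg G u ≡ t
  in-N {x} {t} {u} e = let (xu , cu) = ∧-true e in xu , ⌊⌋-true (deg G u ≟ℕ t) cu
  not-in-N : ∀ {x t u} → N x t u ≡ false → deg G u ≡ t → adj G x u ≡ false
  not-in-N {x} {t} {u} e deg-u rewrite ⌊⌋-yes (deg G u ≟ℕ t) deg-u = trans (≡.sym (∧-identityʳ _)) e

  c : Fin n
  c = proj₁ c-found
  d : Fin n
  d = proj₁ d-found

  ac∈G : adj G a c ≡ true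
  ac∈G = proj₁ (in-N (proj₁ (proj₂ (proj₂ c-found))))
  deg-c : deg G c ≡ toℕ i
  deg-c = proj₂ (in-N (proj₁ (proj₂ (proj₂ c-found))))
  bc∉G : adj G b c ≡ false
  bc∉G = not-in-N (proj₂ (proj₂ (proj₂ c-found))) deg-c
  bd∈G : adj G b d ≡ true
  bd∈G = proj₁ (in-N (proj₁ (proj₂ (proj₂ d-found))))
  deg-d : deg G d ≡ toℕ k
  deg-d = proj₂ (in-N (proj₁ (proj₂ (proj₂ d-found))))
  ad∉G : adj G a d ≡ false
  ad∉G = not-in-N (proj₂ (proj₂ (proj₂ d-found))) deg-d

  site : SwapSite G
  site = record
    { a = a ; b = b ; c = c ; d = d
    ; a≢b = λ a≡b → m+1+n≰m (spec G b (toℕ i))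
                      (subst (λ z → spec G b (toℕ i) + 2 ≤ spec G z (toℕ i)) a≡b surplus-a)
    ; a≢c = status-differs G (irrefl G a) ac∈G
    ; a≢d = proj₁ (proj₂ d-found) ∘ ≡.sym
    ; b≢c = proj₁ (proj₂ c-found) ∘ ≡.sym
    ; b≢d = status-differs G (irrefl G b) bd∈G
    ; c≢d = status-differs G ad∉G ac∈G ∘ ≡.sym
    ; ac∈G = ac∈G ; bd∈G = bd∈G ; bc∉G = bc∉G ; ad∉G = ad∉G
    ; deg-a≡deg-b = deg-a≡deg-b }

  surplus-b : spec G a (toℕ k) + 1 ≤ spec G b (toℕ k)
  surplus-b = ≤-trans (m≤m+n (spec G a (toℕ k) + 1) _) (proj₂ (proj₂ k-found))

  improvement : Improvement G
  improvement = record
    { H = H ; rso = isRSO ; lower = Φ-lower (proj₁ (proj₂ k-found) ∘ ≡.sym) deg-c deg-d surplus-a surplus-b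
    ; degrees = deg-H ; pairs = ordPairs-H }
    where open AfterSwap G site

NearBalanced : ∀ {n} → Graph n → Set
NearBalanced G = ∀ a b → deg G a ≡ deg G b → ∀ i → spec G a i ≤ spec G b i + 1

-- A near-balanced graph is balanced: A_j(i) is the average of the values
-- s_G(v)_i over V_j, and these values are within one of each other.
nearBalanced⇒balanced : ∀ {n} (G : Graph n) → NearBalanced G → Balanced G
nearBalanced⇒balanced G near j v deg-v i
  rewrite Anum≡ordPairs G j i = near-average (class G j) (λ w → spec G w i) v in-V_j close
  where
  in-V_j : class G j v ≡ true
  in-V_j = ⌊⌋-yes (deg G v ≟ℕ j) deg-v
  close : ∀ w → class G j w ≡ true → spec G w i ≤ spec G v i + 1 × spec G v i ≤ spec G w i + 1
  close w w∈V_j = let deg-w = ⌊⌋-true (deg G w ≟ℕ j) w∈V_j in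
    near w v (trans deg-w (≡.sym deg-v)) i , near v w (trans deg-v (≡.sym deg-w)) i

violation? : ∀ {n} (G : Graph n) → Dec (Violation G)
violation? G = any? λ a → any? λ b → any? λ i →
  (deg G a ≟ℕ deg G b) ×-dec (spec G b (toℕ i) + 2 ≤? spec G a (toℕ i))

-- Without violations the graph is near-balanced; degrees above n have empty spectra.
no-violation⇒nearBalanced : ∀ {n} (G : Graph n) → ¬ Violation G → NearBalanced G
no-violation⇒nearBalanced {n} G none a b deg-a≡deg-b i with i <? suc n
... | no i≥suc-n = subst (_≤ spec G b i + 1) (≡.sym empty) z≤n
  where
  empty : spec G a i ≡ 0
  empty = trans (countF-cong (λ u → trans (cong (adj G a u ∧_) (⌊⌋-no (deg G u ≟ℕ i)
                  (λ deg-u → i≥suc-n (subst (_< suc n) deg-u (deg<suc G u))))) (∧-zeroʳ (adj G a u))))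
                (trans (countF≡sumF (λ (_ : Fin n) → false)) (sumF-zero {n}))
... | yes i<suc-n = ≤-pred (≤-trans (≰⇒> no-gap) (≤-reflexive (+-suc (spec G b i) 1)))
  where
  no-gap : ¬ (spec G b i + 2 ≤ spec G a i)
  no-gap gap = none (a , b , fromℕ< i<suc-n , deg-a≡deg-b ,
                     subst (λ t → spec G b t + 2 ≤ spec G a t) (≡.sym (toℕ-fromℕ< i<suc-n)) gap)

balance : ∀ {n} (G : Graph n) → Acc _<_ (Φ G) →
          ∃[ G' ] (RSO* G G' × Balanced G' ×
                   (∀ v → deg G' v ≡ deg G v) × (∀ i j → ordPairs G' i j ≡ ordPairs G i j))
balance G (acc smaller) with violation? G
... | no none =
  G , ε , nearBalanced⇒balanced G (no-violation⇒nearBalanced G none) , (λ _ → refl) , (λ _ _ → refl)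
... | yes (a , b , i , deg-a≡deg-b , gap) with FindSite.improvement G a b i deg-a≡deg-b gap
...   | record { H = H ; rso = rso ; lower = lower ; degrees = degrees ; pairs = pairs }
      with balance H (smaller lower)
...     | G' , steps , balanced , degrees′ , pairs′ =
          G' , rso ◅ steps , balanced ,
          (λ v → trans (degrees′ v) (degrees v)) , (λ i j → trans (pairs′ i j) (pairs i j))

corollary1 : ∀ {n} (G : Graph n) → (∀ v → 1 ≤ deg G v) →
    ∃[ G' ] (RSO* G G' × Balanced G' ×
             (∀ v → deg G' v ≡ deg G v) × (∀ i j → J G' i j ≡ J G i j))
corollary1 G _ with balance G (<-wellFounded (Φ G))
... | G' , steps , balanced , degrees , pairs = G' , steps , balanced , degrees , J-cong G' G pairs
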